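{- Let $M,M'$ be in-models. (1) If $w,w'$ are worlds of $M,M'$ with $M,w\sim M',w'$, then $M,w$ and $M',w'$ make true exactly the same formulas of $\mathcal L_{\Rrightarrow}$. (2) If $s,s'$ are states of $M,M'$ with $M,s\sim M',s'$, then $M,s$ and $M',s'$ support exactly the same formulas of $\mathcal L_{\Rrightarrow}$.
   Context: Fix a set $\mathcal P$ of atoms. Formulas of $\mathcal L_{\Rrightarrow}$: $\varphi ::= p \mid \bot \mid (\varphi\wedge\varphi)\mid(\varphi\to\varphi)\mid(\varphi\veebar\varphi)\mid(\varphi\Rrightarrow\varphi)$, $p\in\mathcal P$, with $\veebar$ inquisitive disjunction. An in-model is $M=\langle W,\Sigma,V\rangle$ with $W$ nonempty, $\Sigma(w)$ a set of nonempty subsets of $W$, $V:W\times\mathcal P\to\{0,1\}$. Support at $s\subseteq W$: $M,s\models p$ iff $V(w,p)=1$ for all $w\in s$; $M,s\models\bot$ iff $s=\emptyset$; $\wedge$ conjunctively; $M,s\models\varphi\veebar\psi$ iff $M,s\models\varphi$ or $M,s\models\psi$; $M,s\models\varphi\to\psi$ iff for all $t\subseteq s$, $M,t\models\varphi$ implies $M,t\models\psi$; $M,s\models\varphi\Rrightarrow\psi$ iff for all $w\in s$, $t\in\Sigma(w)$, $M,t\models\varphi$ implies $M,t\models\psi$. Truth: $M,w\models\varphi$ iff $M,\{w\}\models\varphi$. Egli-Milner lifting of $R\subseteq X\times Y$: $A\overline RB$ iff every $a\in A$ has $b\in B$ with $aRb$ and every $b\in B$ has $a\in A$ with $aRb$.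 A bisimulation between $M=\langle W,\Sigma,V\rangle$ and $M'=\langle W',\Sigma',V'\rangle$ is a nonempty $Z\subseteq W\times W'$ such that whenever $wZw'$: $V(w,p)=V'(w',p)$ for all $p$; every $s\in\Sigma(w)$ has some $s'\in\Sigma'(w')$ with $s\overline Zs'$; every $s'\in\Sigma'(w')$ has some $s\in\Sigma(w)$ with $s\overline Zs'$. $M,w\sim M',w'$ iff some bisimulation has $wZw'$; $M,s\sim M',s'$ iff some bisimulation has $s\overline Zs'$. -}

module Defs where

open import Level using (Level; _⊔_) renaming (suc to lsuc; zero to lzero)
open import Data.Bool using (Bool; true; false)
open import Data.Product using (Σ; ∃; _×_; _,_)
open import Data.Sum using (_⊎_)
open import Data.Empty using (⊥)
open import Relation.Binary.PropositionalEquality using (_≡_)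

Pred : Set → Set₁
Pred W = W → Set

_⊆_ : {W : Set} → Pred W → Pred W → Set
s ⊆ t = ∀ x → s x → t x

｛_｝ : {W : Set} → W → Pred W
｛ w ｝ = λ v → v ≡ w

data Form (P : Set) : Set where
  atom : P → Form P
  ⊥f   : Form P
  _∧f_ : Form P → Form P → Form P
  _⇒f_ : Form P → Form P → Form P
  _⊻f_ : Form P → Form P → Form P
  _⇛f_ : Form P → Form P → Form P

record InModel (P : Set) : Set₁ where
  field
    W        : Set
    inhabited : W
    Σm       : W → Pred W → Set
    Σm-ne    : ∀ w s → Σm w s → ∃ λ v → s v
    V        : W → P → Bool
open InModel public

_,_⊨_ : {P : Set} (M : InModel P) → Pred (W M) → Form P → Set₁
M , s ⊨ atom p  = Level.Lift _ (∀ w → s w → V M w p ≡ true)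
M , s ⊨ ⊥f      = Level.Lift _ (∀ w → s w → ⊥)
M , s ⊨ (φ ∧f ψ) = (M , s ⊨ φ) × (M , s ⊨ ψ)
M , s ⊨ (φ ⊻f ψ) = (M , s ⊨ φ) ⊎ (M , s ⊨ ψ)
M , s ⊨ (φ ⇒f ψ) = (t : Pred (W M)) → t ⊆ s → M , t ⊨ φ → M , t ⊨ ψ
M , s ⊨ (φ ⇛f ψ) = (w : W M) → s w → (t : Pred (W M)) → Σm M w t → M , t ⊨ φ → M , t ⊨ ψ

_,_⊩_ : {P : Set} (M : InModel P) → W M → Form P → Set₁
M , w ⊩ φ = M , ｛ w ｝ ⊨ φ

Lift-EM : {X Y : Set} → (X → Y → Set) → Pred X → Pred Y → Set
Lift-EM R A B = (∀ a → A a → ∃ λ b → B b × R a b) × (∀ b → B b → ∃ λ a → A a × R a b)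

record IsBisimulation {P : Set} (M M' : InModel P) (Z : W M → W M' → Set) : Set₁ where
  field
    nonempty : ∃ λ w → ∃ λ w' → Z w w'
    atoms    : ∀ w w' → Z w w' → ∀ p → V M w p ≡ V M' w' p
    forth    : ∀ w w' → Z w w' → ∀ s → Σm M w s → ∃ λ s' → Σm M' w' s' × Lift-EM Z s s'
    back     : ∀ w w' → Z w w' → ∀ s' → Σm M' w' s' → ∃ λ s → Σm M w s × Lift-EM Z s s'

BisimW : {P : Set} (M : InModel P) → W M → (M' : InModel P) → W M' → Set₁
BisimW M w M' w' = ∃ λ (Z : W M → W M' → Set) → IsBisimulation M M' Z × Z w w'

BisimS : {P : Set} (M : InModel P) → Pred (W M) → (M' : InModel P) → Pred (W M') → Set₁
BisimS M s M' s' = ∃ λ (Z : W M → W M' → Set) → IsBisimulation M M' Z × Lift-EM Z s s'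

_⇔_ : ∀ {a b} → Set a → Set b → Set (a ⊔ b)
A ⇔ B = (A → B) × (B → A)

{-# OPTIONS --safe #-}
module Submission where

-- Support is transported along Egli-Milner related states by induction on the
-- formula, simultaneously for all bisimulations. For φ ⇒ ψ a substate t' of s'
-- is matched by the points of s that are related into t'; for φ ⇛ ψ the back
-- clause matches a neighbourhood of w' with one of a related w. In both cases
-- the antecedent φ has to travel backwards, through the converse bisimulation.

open import Defs
open import Data.Product using (_×_; _,_; proj₁; ∃)
open import Data.Sum using (inj₁; inj₂)
open import Level using (lift)
open import Relation.Binary.PropositionalEquality using (refl; sym; trans)

private
  variable
    P X Y : Set

Lift-EM-converse : {R : X → Y → Set} {A : Pred X} {B : Pred Y} →
  Lift-EM R A B → Lift-EM (λ y x → R x y) B A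
Lift-EM-converse (forth , back) = back , forth

Lift-EM-singleton : {R : X → Y → Set} {x : X} {y : Y} →
  R x y → Lift-EM R ｛ x ｝ ｛ y ｝
Lift-EM-singleton {x = x} {y} r =
  (λ { _ refl → y , refl , r }) , (λ { _ refl → x , refl , r })

Lift-EM-restrictʳ : {R : X → Y → Set} {A : Pred X} {B : Pred Y} →
  Lift-EM R A B → (B' : Pred Y) → B' ⊆ B → ∃ λ A' → A' ⊆ A × Lift-EM R A' B'
Lift-EM-restrictʳ {R = R} {A} (_ , back) B' B'⊆B = A' , (λ _ → proj₁) , forth' , back'
  where
  A' : Pred _
  A' x = A x × ∃ λ y → B' y × R x y

  forth' : ∀ x → A' x → ∃ λ y → B' y × R x y
  forth' _ (_ , related) = related

  back' : ∀ y → B' y → ∃ λ x → A' x × R x y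
  back' y y∈B' with back y (B'⊆B y y∈B')
  ... | x , x∈A , r = x , (x∈A , y , y∈B' , r) , r

IsBisimulation-converse : {M M' : InModel P} {Z : W M → W M' → Set} →
  IsBisimulation M M' Z → IsBisimulation M' M (λ w' w → Z w w')
IsBisimulation-converse B = record
  { nonempty = let (w , w' , z) = nonempty in w' , w , z
  ; atoms    = λ w' w z p → sym (atoms w w' z p)
  ; forth    = λ w' w z s' σ → let (s , σs , L) = back w w' z s' σ in s , σs , Lift-EM-converse L
  ; back     = λ w' w z s σ → let (s' , σs' , L) = forth w w' z s σ in s' , σs' , Lift-EM-converse L
  }
  where open IsBisimulation B

BisimW⇒BisimS : {M M' : InModel P} {w : W M} {w' : W M'} →
  BisimW M w M' w' → BisimS M ｛ w ｝ M' ｛ w' ｝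
BisimW⇒BisimS (Z , B , z) = Z , B , Lift-EM-singleton z

⊨-transfer : {M M' : InModel P} {Z : W M → W M' → Set} → IsBisimulation M M' Z →
  (φ : Form P) {s : Pred (W M)} {s' : Pred (W M')} →
  Lift-EM Z s s' → M , s ⊨ φ → M' , s' ⊨ φ
⊨-transfer B (atom p) (_ , back) (lift s⊨p) = lift λ w' w'∈s' →
  let (w , w∈s , z) = back w' w'∈s' in trans (sym (IsBisimulation.atoms B w w' z p)) (s⊨p w w∈s)
⊨-transfer B ⊥f (_ , back) (lift s-empty) = lift λ w' w'∈s' →
  let (w , w∈s , _) = back w' w'∈s' in s-empty w w∈s
⊨-transfer B (φ ∧f ψ) L (s⊨φ , s⊨ψ) = ⊨-transfer B φ L s⊨φ , ⊨-transfer B ψ L s⊨ψ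
⊨-transfer B (φ ⊻f ψ) L (inj₁ s⊨φ) = inj₁ (⊨-transfer B φ L s⊨φ)
⊨-transfer B (φ ⊻f ψ) L (inj₂ s⊨ψ) = inj₂ (⊨-transfer B ψ L s⊨ψ)
⊨-transfer B (φ ⇒f ψ) L s⊨φ⇒ψ t' t'⊆s' t'⊨φ =
  let (t , t⊆s , Lt) = Lift-EM-restrictʳ L t' t'⊆s'
      t⊨φ = ⊨-transfer (IsBisimulation-converse B) φ (Lift-EM-converse Lt) t'⊨φ
  in ⊨-transfer B ψ Lt (s⊨φ⇒ψ t t⊆s t⊨φ)
⊨-transfer B (φ ⇛f ψ) (_ , back) s⊨φ⇛ψ w' w'∈s' t' σt' t'⊨φ =
  let (w , w∈s , z) = back w' w'∈s'
      (t , σt , Lt) = IsBisimulation.back B w w' z t' σt'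
      t⊨φ = ⊨-transfer (IsBisimulation-converse B) φ (Lift-EM-converse Lt) t'⊨φ
  in ⊨-transfer B ψ Lt (s⊨φ⇛ψ w w∈s t σt t⊨φ)

⊨-invariant : {M M' : InModel P} {s : Pred (W M)} {s' : Pred (W M')} →
  BisimS M s M' s' → (φ : Form P) → (M , s ⊨ φ) ⇔ (M' , s' ⊨ φ)
⊨-invariant (_ , B , L) φ =
  ⊨-transfer B φ L , ⊨-transfer (IsBisimulation-converse B) φ (Lift-EM-converse L)

⊩-invariant : {M M' : InModel P} {w : W M} {w' : W M'} →
  BisimW M w M' w' → (φ : Form P) → (M , w ⊩ φ) ⇔ (M' , w' ⊩ φ)
⊩-invariant w∼w' = ⊨-invariant (BisimW⇒BisimS w∼w')

corollary5p7 : {P : Set} (M M' : InModel P) →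
    ((w : W M) (w' : W M') → BisimW M w M' w' →
      (φ : Form P) → (M , w ⊩ φ) ⇔ (M' , w' ⊩ φ))
    × ((s : Pred (W M)) (s' : Pred (W M')) → BisimS M s M' s' →
      (φ : Form P) → (M , s ⊨ φ) ⇔ (M' , s' ⊨ φ))
corollary5p7 M M' = (λ _ _ → ⊩-invariant) , (λ _ _ → ⊨-invariant)
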